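{- Let $G$ be the simple cubic graph with vertex set $\{v_0,\dots,v_9\}$ and edge set $\{v_0v_1, v_0v_5, v_0v_6, v_1v_5, v_5v_6, v_1v_2, v_6v_7, v_2v_7, v_2v_3, v_7v_8, v_3v_4, v_3v_9, v_4v_8, v_8v_9, v_4v_9\}$. Then in every normal $6$-edge-coloring of $G$ the edge $v_2v_7$ is poor.
   Context: A $k$-edge-coloring of a graph is an assignment of colors from $\{1,\dots,k\}$ to its edges such that adjacent edges receive different colors. For an edge-coloring $c$ and a vertex $v$, let $S_c(v)$ be the set of colors of the edges incident to $v$. In a cubic graph, an edge $uv$ is poor with respect to $c$ if $|S_c(u)\cup S_c(v)|=3$ and rich if $|S_c(u)\cup S_c(v)|=5$. An edge-coloring of a cubic graph is normal if every edge is poor or rich. -}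

module Defs where

open import Data.Nat using (ℕ; zero; suc)
open import Data.Fin using (Fin; zero; suc; #_)
open import Data.Fin.Properties using (_≟_)
open import Data.Product using (_×_; _,_; proj₁; proj₂; ∃-syntax)
open import Data.Sum using (_⊎_)
open import Data.List using (List; []; _∷_; length; filter; allFin)
open import Data.Vec using (Vec; []; _∷_; lookup)
open import Relation.Binary.PropositionalEquality using (_≡_; _≢_)
open import Relation.Nullary using (¬_; Dec; yes; no)
open import Relation.Nullary.Decidable using (_⊎-dec_; _×-dec_)
open import Data.Fin.Properties using () renaming (any? to fin-any?)

Vertex : Set
Vertex = Fin 10

Edge : Set
Edge = Fin 15

edgeList : Vec (Vertex × Vertex) 15
edgeList =
    (# 0 , # 1) ∷ (# 0 , # 5) ∷ (# 0 , # 6) ∷ (# 1 , # 5) ∷ (# 5 , # 6)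
  ∷ (# 1 , # 2) ∷ (# 6 , # 7) ∷ (# 2 , # 7) ∷ (# 2 , # 3) ∷ (# 7 , # 8)
  ∷ (# 3 , # 4) ∷ (# 3 , # 9) ∷ (# 4 , # 8) ∷ (# 8 , # 9) ∷ (# 4 , # 9) ∷ []

endpoints : Edge → Vertex × Vertex
endpoints e = lookup edgeList e

IncidentTo : Vertex → Edge → Set
IncidentTo v e = (proj₁ (endpoints e) ≡ v) ⊎ (proj₂ (endpoints e) ≡ v)

incident? : (v : Vertex) (e : Edge) → Dec (IncidentTo v e)
incident? v e = (proj₁ (endpoints e) ≟ v) ⊎-dec (proj₂ (endpoints e) ≟ v)

e27 : Edge
e27 = # 7

Color : ℕ → Set
Color k = Fin k

IsEdgeColoring : ∀ {k} → (Edge → Color k) → Set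
IsEdgeColoring c = ∀ (e f : Edge) (v : Vertex) →
  e ≢ f → IncidentTo v e → IncidentTo v f → c e ≢ c f

InS : ∀ {k} → (Edge → Color k) → Vertex → Color k → Set
InS c v a = ∃[ e ] (IncidentTo v e × c e ≡ a)

inS? : ∀ {k} (c : Edge → Color k) (v : Vertex) (a : Color k) → Dec (InS c v a)
inS? c v a = fin-any? (λ e → incident? v e ×-dec (c e ≟ a))

unionSize : ∀ {k} → (Edge → Color k) → Vertex → Vertex → ℕ
unionSize {k} c u v = length (filter (λ a → inS? c u a ⊎-dec inS? c v a) (allFin k))

Poor : ∀ {k} → (Edge → Color k) → Edge → Set
Poor c e = unionSize c (proj₁ (endpoints e)) (proj₂ (endpoints e)) ≡ 3

Rich : ∀ {k} → (Edge → Color k) → Edge → Set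
Rich c e = unionSize c (proj₁ (endpoints e)) (proj₂ (endpoints e)) ≡ 5

IsNormal : ∀ {k} → (Edge → Color k) → Set
IsNormal c = IsEdgeColoring c × (∀ e → Poor c e ⊎ Rich c e)

module Submission where

-- The vertices v0, v1, v5, v6 and v3, v4, v8, v9 span two diamonds (K4 minus an edge) hanging
-- off the edge v2v7.  In a normal colouring, the third edge at the apex t of a triangle abt has
-- the colour of ab when ab is poor, and none of the five colours around ab when ab is rich.
-- Applying this to both triangles of a diamond, and using that there are only six colours, the
-- two pendant edges of a diamond get the same colour.  So v2 and v7 see the same three colours.

open import Defs
open import Data.Fin using (Fin; #_)
open import Data.Fin.Properties using (_≟_; all?)
open import Data.Nat using (ℕ; suc; _≤_; _<_; s≤s; s≤s⁻¹; z≤n)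
open import Data.Nat.Properties using (≤-reflexive; ≤-trans; ≤-antisym; <-irrefl; <-≤-trans; <⇒≱)
open import Data.Nat.Properties using () renaming (_≟_ to _≟ℕ_)
open import Data.Product using (_×_; _,_; proj₁; proj₂; uncurry)
open import Data.Sum using (_⊎_; inj₁; inj₂; [_,_])
import Data.Sum as Sum
open import Data.List using (List; []; _∷_; _++_; length; filter; allFin)
open import Data.List.Properties using (filter-notAll; filter-≐; length-tabulate)
open import Data.List.Membership.Propositional using (_∈_)
open import Data.List.Membership.Propositional.Properties
  using (∈-filter⁺; ∈-filter⁻; ∈-allFin; ∈-map⁺; ∈-map⁻; ∈-++⁺ˡ; ∈-++⁺ʳ; ∈-++⁻)
open import Data.List.Relation.Binary.Subset.Propositional using (_⊆_)
open import Data.List.Relation.Binary.Subset.Propositional.Properties using (xs⊆x∷xs)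
open import Data.List.Relation.Unary.All as All using (All; []; _∷_)
open import Data.List.Relation.Unary.Any as Any using (here; there)
open import Data.List.Relation.Unary.AllPairs using ([]; _∷_)
open import Data.List.Relation.Unary.Unique.Propositional using (Unique)
open import Data.List.Relation.Unary.Unique.Propositional.Properties using (filter⁺; allFin⁺)
open import Data.List.Relation.Unary.Unique.DecPropositional (_≟_ {15}) using (unique?)
open import Function using (_∘_; id)
open import Relation.Binary.Definitions using (DecidableEquality)
open import Relation.Binary.PropositionalEquality
  using (_≡_; _≢_; refl; sym; trans; cong; cong₂; ≢-sym; module ≡-Reasoning)
open import Relation.Nullary using (Dec; yes; no; ¬?; contradiction)
open import Relation.Nullary.Decidable using (True; toWitness; from-yes; map′; _×-dec_)

module _ {a} {A : Set a} (_≟ᴬ_ : DecidableEquality A) where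

  unique-length-≤ : ∀ {xs ys : List A} → Unique xs → xs ⊆ ys → length xs ≤ length ys
  unique-length-≤ {[]} _ _ = z≤n
  unique-length-≤ {x ∷ xs} {ys} (x∉xs ∷ unique) xs⊆ys =
    <-≤-trans (s≤s (unique-length-≤ unique xs⊆others)) (filter-notAll (¬? ∘ (x ≟ᴬ_)) ys x∈ys)
    where
    xs⊆others : xs ⊆ filter (¬? ∘ (x ≟ᴬ_)) ys
    xs⊆others z∈xs = ∈-filter⁺ (¬? ∘ (x ≟ᴬ_)) (xs⊆ys (there z∈xs)) (All.lookup x∉xs z∈xs)
    x∈ys = Any.map (λ x≡y x≢y → x≢y x≡y) (xs⊆ys (here refl))

  unique-⊆-length⇒⊇ : ∀ {xs ys : List A} → Unique xs → xs ⊆ ys → length ys ≤ length xs → ys ⊆ xs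
  unique-⊆-length⇒⊇ {xs} {ys} unique xs⊆ys short {y} y∈ys with Any.any? (y ≟ᴬ_) xs
  ... | yes y∈xs = y∈xs
  ... | no y∉xs =
    contradiction (<-≤-trans (unique-length-≤ (y∉xs′ ∷ unique) y∷xs⊆ys) short) (<-irrefl refl)
    where
    y∉xs′ : All (y ≢_) xs
    y∉xs′ = All.tabulate λ z∈xs y≡z → y∉xs (Any.map (trans y≡z) z∈xs)
    y∷xs⊆ys : y ∷ xs ⊆ ys
    y∷xs⊆ys (here refl) = y∈ys
    y∷xs⊆ys (there z∈xs) = xs⊆ys z∈xs

module _ {k : ℕ} where

  open import Data.List.Membership.DecPropositional (_≟_ {k}) using (_∈?_)

  colours : List (Fin k) → List (Fin k)
  colours xs = filter (_∈? xs) (allFin k)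

  ∣_∣ : List (Fin k) → ℕ
  ∣ xs ∣ = length (colours xs)

  ∈-colours⁺ : ∀ {xs a} → a ∈ xs → a ∈ colours xs
  ∈-colours⁺ {xs} {a} = ∈-filter⁺ (_∈? xs) (∈-allFin a)

  colours⊆ : ∀ {xs} → colours xs ⊆ xs
  colours⊆ {xs} = proj₂ ∘ ∈-filter⁻ (_∈? xs) {xs = allFin k}

  colours-unique : ∀ xs → Unique (colours xs)
  colours-unique xs = filter⁺ (_∈? xs) (allFin⁺ k)

  length≤∣∣ : ∀ {xs ys} → Unique ys → ys ⊆ xs → length ys ≤ ∣ xs ∣
  length≤∣∣ unique ys⊆xs = unique-length-≤ _≟_ unique (∈-colours⁺ ∘ ys⊆xs)

  ∣∣≤length : ∀ {xs ys} → xs ⊆ ys → ∣ xs ∣ ≤ length ys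
  ∣∣≤length {xs} xs⊆ys = unique-length-≤ _≟_ (colours-unique xs) (xs⊆ys ∘ colours⊆)

  ∣∣≡length⇒unique : ∀ xs → ∣ xs ∣ ≡ length xs → Unique xs
  ∣∣≡length⇒unique [] _ = []
  ∣∣≡length⇒unique (x ∷ xs) full = All.tabulate x∉xs ∷ ∣∣≡length⇒unique xs xs-full
    where
    longer : length xs < ∣ x ∷ xs ∣
    longer = ≤-reflexive (sym full)
    x∉xs : ∀ {z} → z ∈ xs → x ≢ z
    x∉xs z∈xs refl = <⇒≱ longer (∣∣≤length λ { (here refl) → z∈xs ; (there y∈xs) → y∈xs })
    xs-full : ∣ xs ∣ ≡ length xs
    xs-full = ≤-antisym (∣∣≤length id) (s≤s⁻¹ (≤-trans longer (∣∣≤length x∷xs⊆x∷colours)))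
      where
      x∷xs⊆x∷colours : x ∷ xs ⊆ x ∷ colours xs
      x∷xs⊆x∷colours (here refl) = here refl
      x∷xs⊆x∷colours (there y∈xs) = there (∈-colours⁺ y∈xs)

  ∣++∣≡length⇒⊆ : ∀ {xs} ys → Unique xs → ∣ xs ++ ys ∣ ≡ length xs → ys ⊆ xs
  ∣++∣≡length⇒⊆ {xs} ys unique saturated =
    unique-⊆-length⇒⊇ _≟_ unique (∈-colours⁺ ∘ ∈-++⁺ˡ) (≤-reflexive saturated)
    ∘ ∈-colours⁺ ∘ ∈-++⁺ʳ xs

  ⊆⇒∣++∣≡length : ∀ {xs ys} → Unique xs → ys ⊆ xs → ∣ xs ++ ys ∣ ≡ length xs
  ⊆⇒∣++∣≡length {xs} unique ys⊆xs =
    ≤-antisym (∣∣≤length ([ id , ys⊆xs ] ∘ ∈-++⁻ xs)) (length≤∣∣ unique ∈-++⁺ˡ)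

  Normal : List (Fin k) → Set
  Normal xs = ∣ xs ∣ ≡ 3 ⊎ ∣ xs ∣ ≡ 5

  missing-colours-agree : ∀ {xs y z} → Unique xs → suc (length xs) ≡ k →
                          All (y ≢_) xs → All (z ≢_) xs → y ≡ z
  missing-colours-agree {xs} {y} {z} unique room y∉xs z∉xs with y ≟ z
  ... | yes y≡z = y≡z
  ... | no y≢z =
    contradiction (≤-trans too-many (≤-reflexive (length-tabulate {n = k} id))) (<-irrefl room)
    where
    too-many : length (y ∷ z ∷ xs) ≤ length (allFin k)
    too-many = unique-length-≤ _≟_ ((y≢z ∷ y∉xs) ∷ z∉xs ∷ unique) (λ _ → ∈-allFin {n = k} _)

  -- Colours around a triangle abt: x on ab, p on at, r on bt, and q, s, y on the third edges
  -- at a, b, t.  The lists passed to Normal are the five colours around at and around bt.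

  -- A poor ab forces bt to repeat the colour q, and then at cannot be rich.
  triangle-poor-colours : ∀ {x p q r s y} →
    Unique (x ∷ p ∷ q ∷ []) → Unique (x ∷ r ∷ s ∷ []) → Unique (p ∷ r ∷ y ∷ []) →
    ∣ x ∷ p ∷ q ∷ r ∷ s ∷ [] ∣ ≡ 3 → Normal (p ∷ x ∷ q ∷ r ∷ y ∷ []) → y ≡ x
  triangle-poor-colours {x} {p} {q} {r} {s} {y}
    unique-xpq@((x≢p ∷ x≢q ∷ []) ∷ (p≢q ∷ []) ∷ [] ∷ [])
    ((x≢r ∷ _) ∷ _)
    ((p≢r ∷ p≢y ∷ []) ∷ (r≢y ∷ []) ∷ [] ∷ [])
    poor-ab normal-at = y≡x normal-at
    where
    r≡q : r ≡ q
    r≡q with ∣++∣≡length⇒⊆ (r ∷ s ∷ []) unique-xpq poor-ab (here refl)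
    ... | here r≡x = contradiction (sym r≡x) x≢r
    ... | there (here r≡p) = contradiction (sym r≡p) p≢r
    ... | there (there (here r≡q)) = r≡q
    unique-pxq : Unique (p ∷ x ∷ q ∷ [])
    unique-pxq = (≢-sym x≢p ∷ p≢q ∷ []) ∷ (x≢q ∷ []) ∷ [] ∷ []
    y≡x : Normal (p ∷ x ∷ q ∷ r ∷ y ∷ []) → y ≡ x
    y≡x (inj₂ rich-at) with ∣∣≡length⇒unique (p ∷ x ∷ q ∷ r ∷ y ∷ []) rich-at
    ... | _ ∷ _ ∷ (q≢r ∷ _) ∷ _ = contradiction (sym r≡q) q≢r
    y≡x (inj₁ poor-at) with ∣++∣≡length⇒⊆ (r ∷ y ∷ []) unique-pxq poor-at (there (here refl))
    ... | here y≡p = contradiction (sym y≡p) p≢y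
    ... | there (here y≡x) = y≡x
    ... | there (there (here y≡q)) = contradiction (trans r≡q (sym y≡q)) r≢y

  triangle-rich-colours : ∀ {x p q r s y} →
    Unique (x ∷ p ∷ q ∷ r ∷ s ∷ []) → Unique (p ∷ r ∷ y ∷ []) →
    Normal (p ∷ x ∷ q ∷ r ∷ y ∷ []) → Normal (r ∷ x ∷ s ∷ p ∷ y ∷ []) →
    All (y ≢_) (x ∷ p ∷ q ∷ r ∷ s ∷ [])
  triangle-rich-colours {x} {p} {q} {r} {s} {y}
    ((x≢p ∷ x≢q ∷ x≢r ∷ x≢s ∷ []) ∷ (p≢q ∷ p≢r ∷ p≢s ∷ []) ∷ (q≢r ∷ _) ∷ (r≢s ∷ []) ∷ [] ∷ [])
    ((_ ∷ p≢y ∷ []) ∷ (r≢y ∷ []) ∷ [] ∷ [])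
    normal-at normal-bt
    = ≢-sym x≢y ∷ ≢-sym p≢y ∷ ≢-sym q≢y ∷ ≢-sym r≢y ∷ ≢-sym (bt-avoids normal-bt) ∷ []
    where
    unique-pxq : Unique (p ∷ x ∷ q ∷ [])
    unique-pxq = (≢-sym x≢p ∷ p≢q ∷ []) ∷ (x≢q ∷ []) ∷ [] ∷ []
    unique-rxs : Unique (r ∷ x ∷ s ∷ [])
    unique-rxs = (≢-sym x≢r ∷ r≢s ∷ []) ∷ (x≢s ∷ []) ∷ [] ∷ []
    at-avoids : Normal (p ∷ x ∷ q ∷ r ∷ y ∷ []) → x ≢ y × q ≢ y
    at-avoids (inj₂ rich-at) with ∣∣≡length⇒unique (p ∷ x ∷ q ∷ r ∷ y ∷ []) rich-at
    ... | _ ∷ (_ ∷ _ ∷ x≢y ∷ []) ∷ (_ ∷ q≢y ∷ []) ∷ _ = x≢y , q≢y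
    at-avoids (inj₁ poor-at) with ∣++∣≡length⇒⊆ (r ∷ y ∷ []) unique-pxq poor-at (here refl)
    ... | here r≡p = contradiction (sym r≡p) p≢r
    ... | there (here r≡x) = contradiction (sym r≡x) x≢r
    ... | there (there (here r≡q)) = contradiction (sym r≡q) q≢r
    x≢y = proj₁ (at-avoids normal-at)
    q≢y = proj₂ (at-avoids normal-at)
    bt-avoids : Normal (r ∷ x ∷ s ∷ p ∷ y ∷ []) → s ≢ y
    bt-avoids (inj₂ rich-bt) with ∣∣≡length⇒unique (r ∷ x ∷ s ∷ p ∷ y ∷ []) rich-bt
    ... | _ ∷ _ ∷ (_ ∷ s≢y ∷ []) ∷ _ = s≢y
    bt-avoids (inj₁ poor-bt) with ∣++∣≡length⇒⊆ (p ∷ y ∷ []) unique-rxs poor-bt (here refl)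
    ... | here p≡r = contradiction p≡r p≢r
    ... | there (here p≡x) = contradiction (sym p≡x) x≢p
    ... | there (there (here p≡s)) = contradiction p≡s p≢s

incidentEdges : Vertex → List Edge
incidentEdges v = filter (incident? v) (allFin 15)

cubic : ∀ v → length (incidentEdges v) ≡ 3
cubic = from-yes (all? λ v → length (incidentEdges v) ≟ℕ 3)

-- Since G is cubic, three distinct edges at v are all the edges at v.
record Claw (v : Vertex) (e f g : Edge) : Set where
  constructor mkClaw
  field
    distinct : Unique (e ∷ f ∷ g ∷ [])
    incident : All (IncidentTo v) (e ∷ f ∷ g ∷ [])

claw? : ∀ v e f g → Dec (Claw v e f g)
claw? v e f g = map′ (uncurry mkClaw) (λ w → Claw.distinct w , Claw.incident w)
                     (unique? _ ×-dec All.all? (incident? v) _)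

claw : ∀ {v e f g} {decided : True (claw? v e f g)} → Claw v e f g
claw {decided = decided} = toWitness decided

module _ {v : Vertex} {e f g : Edge} (K : Claw v e f g) where
  open Claw K

  claw-swap : Claw v f e g
  claw-swap with distinct | incident
  ... | (e≢f ∷ e≢g ∷ []) ∷ (f≢g ∷ []) ∷ [] ∷ [] | v-e ∷ v-f ∷ v-g ∷ [] =
    mkClaw ((≢-sym e≢f ∷ f≢g ∷ []) ∷ (e≢g ∷ []) ∷ [] ∷ []) (v-f ∷ v-e ∷ v-g ∷ [])

  claw-edges : ∀ {h} → IncidentTo v h → h ∈ e ∷ f ∷ g ∷ []
  claw-edges {h} v-h = unique-⊆-length⇒⊇ _≟_ distinct at-v (≤-reflexive (cubic v)) (at-v′ v-h)
    where
    at-v′ : ∀ {h} → IncidentTo v h → h ∈ incidentEdges v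
    at-v′ {h} = ∈-filter⁺ (incident? v) (∈-allFin h)
    at-v : e ∷ f ∷ g ∷ [] ⊆ incidentEdges v
    at-v = at-v′ ∘ All.lookup incident

  module _ {k} {c : Edge → Fin k} where

    claw-colours-unique : IsEdgeColoring c → Unique (c e ∷ c f ∷ c g ∷ [])
    claw-colours-unique proper with distinct | incident
    ... | (e≢f ∷ e≢g ∷ []) ∷ (f≢g ∷ []) ∷ [] ∷ [] | v-e ∷ v-f ∷ v-g ∷ [] =
      (proper e f v e≢f v-e v-f ∷ proper e g v e≢g v-e v-g ∷ []) ∷ (proper f g v f≢g v-f v-g ∷ []) ∷ [] ∷ []

    claw-colours⁺ : ∀ {a} → InS c v a → a ∈ c e ∷ c f ∷ c g ∷ []
    claw-colours⁺ (h , v-h , refl) = ∈-map⁺ c (claw-edges v-h)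

    claw-colours⁻ : ∀ {a} → a ∈ c e ∷ c f ∷ c g ∷ [] → InS c v a
    claw-colours⁻ a∈ with ∈-map⁻ c a∈
    ... | h , h∈ , refl = h , All.lookup incident h∈ , refl

Joins : Vertex → Vertex → Edge → Set
Joins u v e = endpoints e ≡ (u , v) ⊎ endpoints e ≡ (v , u)

module _ {k} {c : Edge → Fin k} where

  unionSize-comm : ∀ u v → unionSize c u v ≡ unionSize c v u
  unionSize-comm u v = cong length (filter-≐ _ _ (Sum.swap , Sum.swap) (allFin k))

  union-colours : ∀ {u v e f₁ f₂ g₁ g₂} → Claw u e f₁ f₂ → Claw v e g₁ g₂ →
                  unionSize c u v ≡ ∣ c e ∷ c f₁ ∷ c f₂ ∷ c g₁ ∷ c g₂ ∷ [] ∣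
  union-colours {u} {v} {e} {f₁} {f₂} {g₁} {g₂} Ku Kv =
    cong length (filter-≐ _ _ (to , from) (allFin k))
    where
    to : ∀ {a} → InS c u a ⊎ InS c v a → a ∈ c e ∷ c f₁ ∷ c f₂ ∷ c g₁ ∷ c g₂ ∷ []
    to (inj₁ u-a) = ∈-++⁺ˡ (claw-colours⁺ Ku {c = c} u-a)
    to (inj₂ v-a) with claw-colours⁺ Kv {c = c} v-a
    ... | here a≡e = here a≡e
    ... | there a∈g = there (there (there a∈g))
    from : ∀ {a} → a ∈ c e ∷ c f₁ ∷ c f₂ ∷ c g₁ ∷ c g₂ ∷ [] → InS c u a ⊎ InS c v a
    from a∈ = Sum.map (claw-colours⁻ Ku {c = c}) (claw-colours⁻ Kv {c = c} ∘ there)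
                      (∈-++⁻ (c e ∷ c f₁ ∷ c f₂ ∷ []) a∈)

  edge-colours : ∀ {u v e f₁ f₂ g₁ g₂} → Joins u v e → Claw u e f₁ f₂ → Claw v e g₁ g₂ →
                 unionSize c (proj₁ (endpoints e)) (proj₂ (endpoints e))
                   ≡ ∣ c e ∷ c f₁ ∷ c f₂ ∷ c g₁ ∷ c g₂ ∷ [] ∣
  edge-colours (inj₁ uv) Ku Kv = trans (cong (uncurry (unionSize c)) uv) (union-colours Ku Kv)
  edge-colours {u} {v} (inj₂ vu) Ku Kv =
    trans (cong (uncurry (unionSize c)) vu) (trans (unionSize-comm v u) (union-colours Ku Kv))

  edge-normal : ∀ {u v e f₁ f₂ g₁ g₂} → IsNormal c →
                Joins u v e → Claw u e f₁ f₂ → Claw v e g₁ g₂ → Normal (c e ∷ c f₁ ∷ c f₂ ∷ c g₁ ∷ c g₂ ∷ [])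
  edge-normal {e = e} normal uv Ku Kv =
    Sum.map (trans (sym colours-e)) (trans (sym colours-e)) (proj₂ normal e)
    where
    colours-e = edge-colours uv Ku Kv

-- The triangle abt with sides ab, at, bt; ea, eb, et are the third edges at a, b, t.
record Triangle (a b t : Vertex) (ab at bt ea eb et : Edge) : Set where
  field
    claw-a : Claw a ab at ea
    claw-b : Claw b ab bt eb
    claw-t : Claw t at bt et
    joins-ab : Joins a b ab
    joins-at : Joins a t at
    joins-bt : Joins b t bt

module _ {k} {c : Edge → Fin k} (normal : IsNormal c)
         {a b t ab at bt ea eb et} (T : Triangle a b t ab at bt ea eb et) where
  open Triangle T

  base-colours : unionSize c (proj₁ (endpoints ab)) (proj₂ (endpoints ab))
                   ≡ ∣ c ab ∷ c at ∷ c ea ∷ c bt ∷ c eb ∷ [] ∣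
  base-colours = edge-colours {c = c} joins-ab claw-a claw-b

  triangle-poor : Poor c ab → c et ≡ c ab
  triangle-poor poor =
    triangle-poor-colours (claw-colours-unique claw-a {c = c} (proj₁ normal))
                          (claw-colours-unique claw-b {c = c} (proj₁ normal))
                          (claw-colours-unique claw-t {c = c} (proj₁ normal))
                          (trans (sym base-colours) poor)
                          (edge-normal {c = c} normal joins-at (claw-swap claw-a) claw-t)

  triangle-rich : Rich c ab → All (c et ≢_) (c ab ∷ c at ∷ c ea ∷ c bt ∷ c eb ∷ [])
  triangle-rich rich =
    triangle-rich-colours (∣∣≡length⇒unique _ (trans (sym base-colours) rich))
                          (claw-colours-unique claw-t {c = c} (proj₁ normal))
                          (edge-normal {c = c} normal joins-at (claw-swap claw-a) claw-t)
                          (edge-normal {c = c} normal joins-bt (claw-swap claw-b) (claw-swap claw-t))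

pendants-agree : ∀ {c : Edge → Fin 6} {a b t s ab at bt as bs et es} → IsNormal c →
                 Triangle a b t ab at bt as bs et → Triangle a b s ab as bs at bt es → c et ≡ c es
pendants-agree {c = c} {ab = ab} {at} {bt} {as} {bs} normal T U =
  [ poor-base , rich-base ] (proj₂ normal ab)
  where
  poor-base : Poor c ab → _
  poor-base poor =
    trans (triangle-poor {c = c} normal T poor) (sym (triangle-poor {c = c} normal U poor))
  reorder : ∀ {P : Fin 6 → Set} {x p q r s} →
            All P (x ∷ q ∷ p ∷ s ∷ r ∷ []) → All P (x ∷ p ∷ q ∷ r ∷ s ∷ [])
  reorder (Px ∷ Pq ∷ Pp ∷ Ps ∷ Pr ∷ []) = Px ∷ Pp ∷ Pq ∷ Pr ∷ Ps ∷ []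
  rich-base : Rich c ab → _
  rich-base rich = missing-colours-agree base-unique refl
    (triangle-rich {c = c} normal T rich) (reorder (triangle-rich {c = c} normal U rich))
    where
    base-unique : Unique (c ab ∷ c at ∷ c as ∷ c bt ∷ c bs ∷ [])
    base-unique = ∣∣≡length⇒unique _ (trans (sym (base-colours {c = c} normal T)) rich)

e01 e05 e06 e15 e56 e12 e67 e23 e78 e34 e39 e48 e89 e49 : Edge
e01 = # 0
e05 = # 1
e06 = # 2
e15 = # 3
e56 = # 4
e12 = # 5
e67 = # 6
e23 = # 8
e78 = # 9
e34 = # 10
e39 = # 11
e48 = # 12
e89 = # 13
e49 = # 14

triangle-015 : Triangle (# 0) (# 5) (# 1) e05 e01 e15 e06 e56 e12
triangle-015 = record
  { claw-a = claw ; claw-b = claw ; claw-t = claw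
  ; joins-ab = inj₁ refl ; joins-at = inj₁ refl ; joins-bt = inj₂ refl }

triangle-056 : Triangle (# 0) (# 5) (# 6) e05 e06 e56 e01 e15 e67
triangle-056 = record
  { claw-a = claw ; claw-b = claw ; claw-t = claw
  ; joins-ab = inj₁ refl ; joins-at = inj₁ refl ; joins-bt = inj₁ refl }

triangle-493 : Triangle (# 4) (# 9) (# 3) e49 e34 e39 e48 e89 e23
triangle-493 = record
  { claw-a = claw ; claw-b = claw ; claw-t = claw
  ; joins-ab = inj₁ refl ; joins-at = inj₂ refl ; joins-bt = inj₂ refl }

triangle-498 : Triangle (# 4) (# 9) (# 8) e49 e48 e89 e34 e39 e78
triangle-498 = record
  { claw-a = claw ; claw-b = claw ; claw-t = claw
  ; joins-ab = inj₁ refl ; joins-at = inj₁ refl ; joins-bt = inj₂ refl }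

proposition3 : (c : Edge → Fin 6) → IsNormal c → Poor c e27
proposition3 c normal = begin
  unionSize c (# 2) (# 7)                        ≡⟨ union-colours {c = c} claw-2 claw-7 ⟩
  ∣ c e27 ∷ c e12 ∷ c e23 ∷ c e67 ∷ c e78 ∷ [] ∣  ≡⟨ cong₂ (λ y z → ∣ c e27 ∷ c e12 ∷ c e23 ∷ y ∷ z ∷ [] ∣)
                                                          (sym left-pendants) (sym right-pendants) ⟩
  ∣ c e27 ∷ c e12 ∷ c e23 ∷ c e12 ∷ c e23 ∷ [] ∣  ≡⟨ ⊆⇒∣++∣≡length colours-2-unique (xs⊆x∷xs _ _) ⟩
  3                                              ∎
  where
  open ≡-Reasoning
  claw-2 : Claw (# 2) e27 e12 e23
  claw-2 = claw
  claw-7 : Claw (# 7) e27 e67 e78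
  claw-7 = claw
  colours-2-unique : Unique (c e27 ∷ c e12 ∷ c e23 ∷ [])
  colours-2-unique = claw-colours-unique claw-2 (proj₁ normal)
  left-pendants : c e12 ≡ c e67
  left-pendants = pendants-agree normal triangle-015 triangle-056
  right-pendants : c e23 ≡ c e78
  right-pendants = pendants-agree normal triangle-493 triangle-498
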